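{- Let $n\ge1$ and work with words over the alphabet $\{\mathsf s_1,\dots,\mathsf s_n\}$. Let $\mathsf w_\circ(\mathsf c)=\prod_{i=1}^{n}\big(\mathsf s_1\mathsf s_2\cdots\mathsf s_{n+1-i}\big)$ (concatenation in increasing order of $i$). Then $\mathsf w_\circ(\mathsf c)$ can be transformed into the word $\mathsf w_\circ(\mathsf c)\,\mathsf s_n\mathsf s_{n-1}\cdots\mathsf s_1$ by doubling all its letters $\mathsf s_1$ and applying a sequence of $n(n-1)/2$ braid moves interlaced with some commutation moves.
   Context: A commutation move replaces a factor $\mathsf s_i\mathsf s_j$ of a word by $\mathsf s_j\mathsf s_i$ when $|i-j|\ge2$. A braid move replaces a factor $\mathsf s_i\mathsf s_j\mathsf s_i$ by $\mathsf s_j\mathsf s_i\mathsf s_j$ when $|i-j|=1$. Doubling a letter $\mathsf s_i$ means replacing it in the word by the factor $\mathsf s_i\mathsf s_i$. -}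

module Defs where

open import Data.Nat using (ℕ; zero; suc; _≤_; ∣_-_∣)
open import Data.List using (List; []; _∷_; _++_; map; upTo; downFrom)
open import Data.Product using (∃-syntax; _×_)
open import Relation.Binary.PropositionalEquality using (_≡_)

-- A word over {s_1, ..., s_n}: the letter s_i is represented by the natural number i.
Word : Set
Word = List ℕ

asc : ℕ → Word
asc k = map suc (upTo k)

desc : ℕ → Word
desc k = map suc (downFrom k)

stair : ℕ → Word
stair zero    = []
stair (suc k) = asc (suc k) ++ stair k

wc : ℕ → Word
wc n = stair n

double1 : Word → Word
double1 []            = []
double1 (1 ∷ w)       = 1 ∷ 1 ∷ double1 w
double1 (a ∷ w)       = a ∷ double1 w

CommMove : Word → Word → Set
CommMove u v = ∃[ p ] ∃[ s ] ∃[ i ] ∃[ j ]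
  (2 ≤ ∣ i - j ∣ × u ≡ p ++ i ∷ j ∷ s × v ≡ p ++ j ∷ i ∷ s)

BraidMove : Word → Word → Set
BraidMove u v = ∃[ p ] ∃[ s ] ∃[ i ] ∃[ j ]
  (∣ i - j ∣ ≡ 1 × u ≡ p ++ i ∷ j ∷ i ∷ s × v ≡ p ++ j ∷ i ∷ j ∷ s)

data Moves : ℕ → Word → Word → Set where
  done  : ∀ {w} → Moves 0 w w
  comm  : ∀ {k u v w} → CommMove u v → Moves k v w → Moves k u w
  braid : ∀ {k u v w} → BraidMove u v → Moves k v w → Moves (suc k) u w

module Submission where

-- The proof rests on three facts about these words, where
-- "≈" means "related by commutation moves only":
--   (A) stair m · desc (m+1) ≈ stair (m+1)                       (no braids);
--   (B) s_{k+1} · desc (k+2) becomes desc (k+2) · s_{k+2} by one braid;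
--   (C) s₁ · stair (m+1) becomes stair (m+1) · s_{m+1} by m braids.
-- (C) is proved by induction on m: expand stair (m+2) by (A), move s₁ through
-- the inner stair by (C), push the resulting s_{m+1} through desc (m+2) by
-- (B) and contract again by (A).  Finally double1 (stair (n+1)) starts with
-- s₁ s₁ · (s₂⋯s_{n+1}) · double1 (stair n); by induction the tail becomes
-- stair n · desc n, and (C) moves the extra s₁ to the end as s_{n+1}.

open import Defs
open import Data.Nat using (ℕ; _≤_; _*_; _∸_; _/_)
open import Data.List using (_++_)
open import Data.Nat using (zero; suc; _+_; z≤n; s≤s; ∣_-_∣)
open import Data.Nat.Properties using (m≤n⇒m≤1+n; ≤-refl; +-comm; ∣-∣-comm; *-distribʳ-+)
open import Data.Nat.DivMod using (m*n/n≡m)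
open import Data.Nat.Solver using (module +-*-Solver)
open import Data.List using ([]; _∷_; [_]; map; applyUpTo)
open import Data.List.Properties using (++-assoc; map-++; upTo-∷ʳ)
open import Data.List.Relation.Unary.All using (All; []; _∷_) renaming (map to all-map)
open import Data.List.Relation.Unary.All.Properties using (map⁺; ++⁺; all-upTo; applyUpTo⁺₂)
open import Data.Product using (_,_)
open import Relation.Binary.PropositionalEquality
  using (_≡_; refl; sym; trans; cong; subst; module ≡-Reasoning)

private
  variable
    k a b : ℕ
    u v w u′ v′ : Word

infixr 5 _▷_
_▷_ : Moves a u v → Moves b v w → Moves (a + b) u w
done      ▷ q = q
comm c p  ▷ q = comm c (p ▷ q)
braid c p ▷ q = braid c (p ▷ q)

infixr 5 _≡▷_
_≡▷_ : u ≡ u′ → Moves k u′ v → Moves k u v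
refl ≡▷ p = p

infixl 6 _◁≡_
_◁≡_ : Moves k u v → v ≡ v′ → Moves k u v′
p ◁≡ refl = p

recount : a ≡ b → Moves a u v → Moves b u v
recount refl p = p

prefix : ∀ p → Moves k u v → Moves k (p ++ u) (p ++ v)
prefix p done        = done
prefix p (comm c m)  = comm (shift c) (prefix p m)
  where
  shift : CommMove u v → CommMove (p ++ u) (p ++ v)
  shift (q , r , i , j , h , refl , refl) =
    p ++ q , r , i , j , h , sym (++-assoc p q _) , sym (++-assoc p q _)
prefix p (braid c m) = braid (shift c) (prefix p m)
  where
  shift : BraidMove u v → BraidMove (p ++ u) (p ++ v)
  shift (q , r , i , j , h , refl , refl) =
    p ++ q , r , i , j , h , sym (++-assoc p q _) , sym (++-assoc p q _)

suffix : ∀ s → Moves k u v → Moves k (u ++ s) (v ++ s)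
suffix s done        = done
suffix s (comm c m)  = comm (shift c) (suffix s m)
  where
  shift : CommMove u v → CommMove (u ++ s) (v ++ s)
  shift (q , r , i , j , h , refl , refl) =
    q , r ++ s , i , j , h , ++-assoc q _ s , ++-assoc q _ s
suffix s (braid c m) = braid (shift c) (suffix s m)
  where
  shift : BraidMove u v → BraidMove (u ++ s) (v ++ s)
  shift (q , r , i , j , h , refl , refl) =
    q , r ++ s , i , j , h , ++-assoc q _ s , ++-assoc q _ s

comm-sym : CommMove u v → CommMove v u
comm-sym (p , s , i , j , h , e₁ , e₂) =
  p , s , j , i , subst (2 ≤_) (∣-∣-comm i j) h , e₂ , e₁

reverse : Moves 0 u v → Moves 0 v u
reverse done       = done
reverse (comm c p) = append (reverse p) (comm-sym c)
  where
  append : Moves k u v → CommMove v w → Moves k u w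
  append done        d = comm d done
  append (comm c p)  d = comm c (append p d)
  append (braid c p) d = braid c (append p d)

Far : ℕ → ℕ → Set
Far x y = 2 ≤ ∣ x - y ∣

far-above : ∀ {x y} → suc (suc y) ≤ x → Far x y
far-above {y = zero}  (s≤s (s≤s _)) = s≤s (s≤s z≤n)
far-above {y = suc y} (s≤s h)       = far-above h

slide : ∀ x w → All (Far x) w → Moves 0 (x ∷ w) (w ++ [ x ])
slide x []      []       = done
slide x (y ∷ w) (h ∷ hs) = comm ([] , w , x , y , h , refl , refl) (prefix [ y ] (slide x w hs))

slide-above : ∀ m w → All (_≤ m) w → Moves 0 (suc (suc m) ∷ w) (w ++ [ suc (suc m) ])
slide-above m w bounded = slide (suc (suc m)) w (all-map (λ h → far-above (s≤s (s≤s h))) bounded)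

asc-bounded : ∀ m → All (_≤ m) (asc m)
asc-bounded m = map⁺ (all-upTo m)

desc-bounded : ∀ m → All (_≤ m) (desc m)
desc-bounded zero    = []
desc-bounded (suc m) = ≤-refl ∷ all-map m≤n⇒m≤1+n (desc-bounded m)

stair-bounded : ∀ m → All (_≤ m) (stair m)
stair-bounded zero    = []
stair-bounded (suc m) = ++⁺ (asc-bounded (suc m)) (all-map m≤n⇒m≤1+n (stair-bounded m))

asc-snoc : ∀ m → asc (suc m) ≡ asc m ++ [ suc m ]
asc-snoc m = trans (cong (map suc) (sym (upTo-∷ʳ m))) (map-++ suc (applyUpTo (λ x → x) m) [ m ])

double1-++ : ∀ u v → double1 (u ++ v) ≡ double1 u ++ double1 v
double1-++ []                  v = refl
double1-++ (zero ∷ u)          v = cong (zero ∷_) (double1-++ u v)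
double1-++ (suc zero ∷ u)      v = cong (λ t → 1 ∷ 1 ∷ t) (double1-++ u v)
double1-++ (suc (suc a) ∷ u)   v = cong (suc (suc a) ∷_) (double1-++ u v)

double1-large : All (2 ≤_) w → double1 w ≡ w
double1-large []                            = refl
double1-large {zero ∷ _}        (() ∷ _)
double1-large {suc zero ∷ _}    (s≤s () ∷ _)
double1-large {suc (suc a) ∷ _} (_ ∷ large) = cong (suc (suc a) ∷_) (double1-large large)

-- The only s₁ in s₁ ⋯ s_{m+1} is its first letter.
double1-asc : ∀ m → double1 (asc (suc m)) ≡ 1 ∷ asc (suc m)
double1-asc m = cong (λ t → 1 ∷ 1 ∷ t)
  (double1-large (map⁺ (applyUpTo⁺₂ suc m (λ _ → s≤s (s≤s z≤n)))))

-- (A) stair m · s_{m+1} ⋯ s₁ ≈ stair (m+1): in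
--     stair (m+1) · s_{m+2} ⋯ s₁ = asc (m+1) · stair m · s_{m+2} · desc (m+1)
-- slide s_{m+2} left across stair m, then recurse.
stair-absorb : ∀ m → Moves 0 (stair m ++ desc (suc m)) (stair (suc m))
stair-absorb zero    = done
stair-absorb (suc m) =
  ++-assoc A (stair m) (top ∷ desc (suc m))
  ≡▷ cong (A ++_) (sym (++-assoc (stair m) [ top ] (desc (suc m))))
  ≡▷ prefix A (suffix (desc (suc m)) (reverse (slide-above m (stair m) (stair-bounded m))))
  ▷ (sym (++-assoc A [ top ] _) ≡▷ prefix (A ++ [ top ]) (stair-absorb m))
  ◁≡ cong (_++ stair (suc m)) (sym (asc-snoc (suc m)))
  where
  A   = asc (suc m)
  top = suc (suc m)

-- (B) s_{k+1} · s_{k+2} s_{k+1} ⋯ s₁ → s_{k+2} ⋯ s₁ · s_{k+2}: one braid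
--     s_{k+1} s_{k+2} s_{k+1} → s_{k+2} s_{k+1} s_{k+2}, then slide s_{k+2}
--     across s_k ⋯ s₁.
braid-past-desc : ∀ k → Moves 1 (suc k ∷ desc (suc (suc k))) (desc (suc (suc k)) ++ [ suc (suc k) ])
braid-past-desc k =
  braid ([] , desc k , suc k , suc (suc k) , adjacent k , refl , refl)
        (prefix (suc (suc k) ∷ suc k ∷ []) (slide-above k (desc k) (desc-bounded k)))
  where
  adjacent : ∀ k → ∣ k - suc k ∣ ≡ 1
  adjacent zero    = refl
  adjacent (suc k) = adjacent k

-- (C) s₁ · stair (m+1) → stair (m+1) · s_{m+1} with m braids
--     (conjugation of s₁ by the longest element).
conjugate-s₁ : ∀ m → Moves m (1 ∷ stair (suc m)) (stair (suc m) ++ [ suc m ])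
conjugate-s₁ zero    = done
conjugate-s₁ (suc m) = recount (+-comm m 1)
  (prefix [ 1 ] (reverse (stair-absorb (suc m)))
  ▷ suffix D (conjugate-s₁ m)
  ▷ (++-assoc S [ suc m ] D ≡▷ prefix S (braid-past-desc m) ◁≡ sym (++-assoc S D _))
  ▷ suffix [ suc (suc m) ] (stair-absorb (suc m)))
  where
  S = stair (suc m)
  D = desc (suc (suc m))

triangle : ℕ → ℕ
triangle zero    = 0
triangle (suc n) = triangle n + n

double-and-braid : ∀ n → Moves (triangle n) (double1 (stair n)) (stair n ++ desc n)
double-and-braid zero    = done
double-and-braid (suc n) =
  trans (double1-++ A (stair n)) (cong (_++ double1 (stair n)) (double1-asc n))
  ≡▷ prefix (1 ∷ A) (double-and-braid n)
  ◁≡ cong (1 ∷_) (sym (++-assoc A (stair n) (desc n)))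
  ▷ suffix (desc n) (conjugate-s₁ n)
  ◁≡ ++-assoc (stair (suc n)) [ suc n ] (desc n)
  where
  A = asc (suc n)

triangle-double : ∀ n → triangle n * 2 ≡ n * (n ∸ 1)
triangle-double zero          = refl
triangle-double (suc zero)    = refl
triangle-double (suc (suc k)) = begin
  (triangle (suc k) + suc k) * 2   ≡⟨ *-distribʳ-+ 2 (triangle (suc k)) (suc k) ⟩
  triangle (suc k) * 2 + suc k * 2 ≡⟨ cong (_+ suc k * 2) (triangle-double (suc k)) ⟩
  suc k * k + suc k * 2            ≡⟨ solve 1 (λ k → (con 1 :+ k) :* k :+ (con 1 :+ k) :* con 2
                                                    := (con 2 :+ k) :* (con 1 :+ k)) refl k ⟩
  suc (suc k) * suc k              ∎
  where
  open ≡-Reasoning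
  open +-*-Solver

triangle-closed : ∀ n → triangle n ≡ (n * (n ∸ 1)) / 2
triangle-closed n = trans (sym (m*n/n≡m (triangle n) 2)) (cong (_/ 2) (triangle-double n))

corollary3p2 : ∀ (n : ℕ) → 1 ≤ n →
    Moves ((n * (n ∸ 1)) / 2) (double1 (wc n)) (wc n ++ desc n)
corollary3p2 n _ = recount (triangle-closed n) (double-and-braid n)
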